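{- (i) Taking inverse limits yields a full functor $P$ from $\mathrm{Pro}_\omega(\mathrm{GrpEpi})$ to the category whose objects are procountable groups and whose morphisms are continuous homomorphisms with dense range; that is, $P$ is a functor, and for any objects $(\overline A,\overline p),(\overline B,\overline q)$ of $\mathrm{Pro}_\omega(\mathrm{GrpEpi})$, every continuous homomorphism with dense range $\varprojlim(\overline A,\overline p)\to\varprojlim(\overline B,\overline q)$ equals $P$ of some morphism $(\overline A,\overline p)\to(\overline B,\overline q)$. (ii) $P$ preserves isomorphisms in both directions: two objects of $\mathrm{Pro}_\omega(\mathrm{GrpEpi})$ are isomorphic in $\mathrm{Pro}_\omega(\mathrm{GrpEpi})$ if and only if their inverse limits are topologically isomorphic.
   Context: $\mathrm{GrpEpi}$ is the category of countable groups with surjective homomorphisms. Objects of $\mathrm{Pro}_\omega(\mathrm{GrpEpi})$ are inverse systems $(\overline A,\overline p)=(A_n,p_n)_{n\in\mathbb{N}}$ with $A_n$ countable groups and $p_n\colon A_{n+1}\to A_n$ surjective homomorphisms; write $p_{k,n}=p_n\circ p_{n+1}\circ\dots\circ p_{k-1}\colon A_k\to A_n$ for $k>n$ (and $p_{n,n}=\mathrm{id}$). A pre-morphism $(\overline f,\phi)\colon(\overline A,\overline p)\to(\overline B,\overline q)$ consists of an increasing $\phi\colon\mathbb{N}\to\mathbb{N}$ and surjective homomorphisms $f_n\colon A_{\phi(n)}\to B_n$ with $q_{k,n}\circ f_k=f_n\circ p_{\phi(k),\phi(n)}$ for all $k>n$. Composition: $(\overline g,\psi)\circ(\overline f,\phi)$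 has index map $\phi\circ\psi$ and components $g_n\circ f_{\psi(n)}$; identity is $((\mathrm{id}_{A_n})_n,\mathrm{id}_{\mathbb{N}})$. Two pre-morphisms $(\overline f,\phi),(\overline f',\phi')$ between the same objects are equivalent if for each $n$ there is $m\ge\phi(n),\phi'(n)$ with $f_n\circ p_{m,\phi(n)}=f'_n\circ p_{m,\phi'(n)}$; morphisms of $\mathrm{Pro}_\omega(\mathrm{GrpEpi})$ are equivalence classes of pre-morphisms. The inverse limit $\varprojlim(\overline A,\overline p)=\{x\in\prod_n A_n:\forall n\ p_n(x(n+1))=x(n)\}$ has the subspace topology of $\prod_n A_n$ with each $A_n$ discrete; such groups are called procountable. $P$ sends a pre-morphism $(\overline f,\phi)$ to the continuous homomorphism $\varprojlim\overline A\to\varprojlim\overline B$ induced by the maps $\varprojlim\overline A\to A_{\phi(n)}\xrightarrow{f_n}B_n$. -}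

module Defs where

open import Level using (0ℓ)
open import Function using (id; _∘_)
open import Data.Nat using (ℕ; zero; suc; _≤_; _<_; _≤′_; ≤′-refl; ≤′-step)
open import Data.Nat.Properties using (≤⇒≤′; ≤′⇒≤; <⇒≤; n<1+n; 1+n≰n)
open import Data.Product using (Σ; Σ-syntax; ∃; _×_; _,_; proj₁; proj₂)
open import Relation.Nullary using (¬_)
open import Data.Empty using (⊥-elim)
import Relation.Binary.PropositionalEquality as P
open import Algebra.Bundles using (Group)
open import Algebra.Structures using (IsGroup; IsMonoid; IsSemigroup; IsMagma)
open import Algebra.Morphism.Structures using (IsGroupHomomorphism)
import Algebra.Morphism.Construct.Composition as Comp
import Algebra.Morphism.Construct.Identity as Ident

open Group using (Carrier; rawGroup)

record Hom (G H : Group 0ℓ 0ℓ) : Set where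
  constructor mkHom
  field
    ⟦_⟧   : Carrier G → Carrier H
    isHom : IsGroupHomomorphism (rawGroup G) (rawGroup H) ⟦_⟧
open Hom public

module _ {G H : Group 0ℓ 0ℓ} (h : Hom G H) where
  open IsGroupHomomorphism (isHom h) public
    renaming (⟦⟧-cong to hom-cong; homo to hom-∙; ε-homo to hom-ε; ⁻¹-homo to hom-⁻¹)

idHom : (G : Group 0ℓ 0ℓ) → Hom G G
idHom G = mkHom id (Ident.isGroupHomomorphism (rawGroup G) (Group.refl G))

_∘H_ : {G H K : Group 0ℓ 0ℓ} → Hom H K → Hom G H → Hom G K
_∘H_ {K = K} g f =
  mkHom (⟦ g ⟧ ∘ ⟦ f ⟧) (Comp.isGroupHomomorphism (Group.trans K) (isHom f) (isHom g))

Surjective : {G H : Group 0ℓ 0ℓ} → Hom G H → Set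
Surjective {G} {H} f = (b : Carrier H) → Σ[ a ∈ Carrier G ] Group._≈_ H (⟦ f ⟧ a) b

-- a group is countable if some map ℕ → Carrier is surjective (groups are nonempty)
Countable : Group 0ℓ 0ℓ → Set
Countable G = Σ[ e ∈ (ℕ → Carrier G) ] ((x : Carrier G) → Σ[ n ∈ ℕ ] Group._≈_ G (e n) x)

-- Objects of Pro_ω(GrpEpi): inverse sequences of countable groups with
-- surjective bonding homomorphisms p n : A (suc n) → A n

record InvSys : Set₁ where
  field
    A         : ℕ → Group 0ℓ 0ℓ
    countable : ∀ n → Countable (A n)
    p         : ∀ n → Hom (A (suc n)) (A n)
    p-surj    : ∀ n → Surjective (p n)

open InvSys public

El : InvSys → ℕ → Set
El S n = Carrier (A S n)

Eq : (S : InvSys) (n : ℕ) → El S n → El S n → Set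
Eq S n = Group._≈_ (A S n)

proj′ : (S : InvSys) {n k : ℕ} → n ≤′ k → El S k → El S n
proj′ S ≤′-refl x = x
proj′ S (≤′-step {k} h) x = proj′ S h (⟦ p S k ⟧ x)

proj : (S : InvSys) {n k : ℕ} → n ≤ k → El S k → El S n
proj S h = proj′ S (≤⇒≤′ h)

StrictlyIncreasing : (ℕ → ℕ) → Set
StrictlyIncreasing φ = ∀ {m n} → m < n → φ m < φ n

record PreMor (S T : InvSys) : Set where
  field
    φ      : ℕ → ℕ
    φ-inc  : StrictlyIncreasing φ
    f      : ∀ n → Hom (A S (φ n)) (A T n)
    f-surj : ∀ n → Surjective (f n)
    f-comm : ∀ {n k} (n<k : n < k) (a : El S (φ k)) →
             Eq T n (proj T (<⇒≤ n<k) (⟦ f k ⟧ a)) (⟦ f n ⟧ (proj S (<⇒≤ (φ-inc n<k)) a))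

open PreMor public

_∼_ : {S T : InvSys} → PreMor S T → PreMor S T → Set
_∼_ {S} {T} F G = ∀ n → Σ[ m ∈ ℕ ] Σ[ h₁ ∈ φ F n ≤ m ] Σ[ h₂ ∈ φ G n ≤ m ]
  ((a : El S m) → Eq T n (⟦ f F n ⟧ (proj S h₁ a)) (⟦ f G n ⟧ (proj S h₂ a)))

idPre : (S : InvSys) → PreMor S S
idPre S = record
  { φ = id ; φ-inc = id ; f = λ n → idHom (A S n)
  ; f-surj = λ n b → b , Group.refl (A S n)
  ; f-comm = λ {n} n<k a → Group.refl (A S n) }

_∘P_ : {S T U : InvSys} → PreMor T U → PreMor S T → PreMor S U
_∘P_ {S} {T} {U} G F = record
  { φ = φ F ∘ φ G
  ; φ-inc = φ-inc F ∘ φ-inc G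
  ; f = λ n → f G n ∘H f F (φ G n)
  ; f-surj = λ n c →
      let (b , eb) = f-surj G n c
          (a , ea) = f-surj F (φ G n) b
      in a , Group.trans (A U n) (hom-cong (f G n) ea) eb
  ; f-comm = λ {n} n<k a →
      Group.trans (A U n) (f-comm G n<k (⟦ f F (φ G _) ⟧ a))
        (hom-cong (f G n) (f-comm F (φ-inc G n<k) a))
  }

record Thread (S : InvSys) : Set where
  constructor thread
  field
    pt     : (n : ℕ) → El S n
    compat : ∀ n → Eq S n (⟦ p S n ⟧ (pt (suc n))) (pt n)
open Thread public

module LimConstr (S : InvSys) where
  module G n = Group (A S n)

  _≋_ : Thread S → Thread S → Set
  x ≋ y = ∀ n → Eq S n (pt x n) (pt y n)

  _·_ : Thread S → Thread S → Thread S
  x · y = thread (λ n → G._∙_ n (pt x n) (pt y n))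
    (λ n → G.trans n (hom-∙ (p S n) (pt x (suc n)) (pt y (suc n)))
                      (G.∙-cong n (compat x n) (compat y n)))

  e : Thread S
  e = thread (λ n → G.ε n) (λ n → hom-ε (p S n))

  inv : Thread S → Thread S
  inv x = thread (λ n → G._⁻¹ n (pt x n))
    (λ n → G.trans n (hom-⁻¹ (p S n) (pt x (suc n))) (G.⁻¹-cong n (compat x n)))

  isGroup : IsGroup _≋_ _·_ e inv
  isGroup = record
    { isMonoid = record
      { isSemigroup = record
        { isMagma = record
          { isEquivalence = record
            { refl = λ n → G.refl n
            ; sym = λ h n → G.sym n (h n)
            ; trans = λ h k n → G.trans n (h n) (k n) }
          ; ∙-cong = λ h k n → G.∙-cong n (h n) (k n) }
        ; assoc = λ x y z n → G.assoc n (pt x n) (pt y n) (pt z n) }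
      ; identity = (λ x n → G.identityˡ n (pt x n)) , (λ x n → G.identityʳ n (pt x n)) }
    ; inverse = (λ x n → G.inverseˡ n (pt x n)) , (λ x n → G.inverseʳ n (pt x n))
    ; ⁻¹-cong = λ h n → G.⁻¹-cong n (h n) }

Lim : InvSys → Group 0ℓ 0ℓ
Lim S = record { isGroup = LimConstr.isGroup S }

-- Topology of the inverse limit (subspace of the product of discrete groups).
-- Basic neighbourhoods of x are the cylinders  {y | y k = x k for all k ≤ m}.

Agree : (S : InvSys) → ℕ → Thread S → Thread S → Set
Agree S m x y = ∀ k → k ≤ m → Eq S k (pt x k) (pt y k)

Continuous : {S T : InvSys} → (Thread S → Thread T) → Set
Continuous {S} {T} h =
  ∀ x n → Σ[ m ∈ ℕ ] (∀ y → Agree S m x y → Agree T n (h x) (h y))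

DenseRange : {S T : InvSys} → (Thread S → Thread T) → Set
DenseRange {S} {T} h = ∀ y n → Σ[ x ∈ Thread S ] Agree T n (h x) y

_≗L_ : {S T : InvSys} → Hom (Lim S) (Lim T) → Hom (Lim S) (Lim T) → Set
_≗L_ {S} {T} h g = ∀ x → Group._≈_ (Lim T) (⟦ h ⟧ x) (⟦ g ⟧ x)

TopIso : InvSys → InvSys → Set
TopIso S T = Σ[ h ∈ Hom (Lim S) (Lim T) ] Σ[ g ∈ Hom (Lim T) (Lim S) ]
  (Continuous ⟦ h ⟧ × Continuous ⟦ g ⟧ ×
   (g ∘H h) ≗L idHom (Lim S) × (h ∘H g) ≗L idHom (Lim T))

ProIso : InvSys → InvSys → Set
ProIso S T = Σ[ F ∈ PreMor S T ] Σ[ G ∈ PreMor T S ]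
  ((G ∘P F) ∼ idPre S × (F ∘P G) ∼ idPre T)

proj′-thread : (S : InvSys) (x : Thread S) {n k : ℕ} (h : n ≤′ k) →
               Eq S n (proj′ S h (pt x k)) (pt x n)
proj′-thread S x ≤′-refl = Group.refl (A S _)
proj′-thread S x (≤′-step {k} h) =
  Group.trans (A S _) (proj′-cong h (compat x k)) (proj′-thread S x h)
  where
  proj′-cong : ∀ {n k} (h : n ≤′ k) {a b : El S k} → Eq S k a b →
               Eq S n (proj′ S h a) (proj′ S h b)
  proj′-cong ≤′-refl e = e
  proj′-cong (≤′-step {k} h) e = proj′-cong h (hom-cong (p S k) e)

proj′-self : (S : InvSys) {n : ℕ} (h : n ≤′ n) (a : El S n) → proj′ S h a P.≡ a
proj′-self S ≤′-refl a = P.refl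
proj′-self S (≤′-step h) a = ⊥-elim (1+n≰n (≤′⇒≤ h))

proj′-step : (S : InvSys) {n : ℕ} (h : n ≤′ suc n) (a : El S (suc n)) →
             proj′ S h a P.≡ ⟦ p S n ⟧ a
proj′-step S (≤′-step h) a = proj′-self S h _

P₀ : {S T : InvSys} → PreMor S T → Thread S → Thread T
P₀ {S} {T} F x = thread (λ n → ⟦ f F n ⟧ (pt x (φ F n)))
  (λ n → Group.trans (A T n)
     (Group.reflexive (A T n) (P.sym (proj′-step T (≤⇒≤′ (<⇒≤ (n<1+n n))) _)))
     (Group.trans (A T n) (f-comm F (n<1+n n) (pt x (φ F (suc n))))
        (hom-cong (f F n) (proj′-thread S x (≤⇒≤′ (<⇒≤ (φ-inc F (n<1+n n))))))))

P : {S T : InvSys} → PreMor S T → Hom (Lim S) (Lim T)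
P {S} {T} F = mkHom (P₀ F) (record
  { isMonoidHomomorphism = record
    { isMagmaHomomorphism = record
      { isRelHomomorphism = record { cong = λ e n → hom-cong (f F n) (e (φ F n)) }
      ; homo = λ x y n → hom-∙ (f F n) (pt x (φ F n)) (pt y (φ F n)) }
    ; ε-homo = λ n → hom-ε (f F n) }
  ; ⁻¹-homo = λ x n → hom-⁻¹ (f F n) (pt x (φ F n)) })

{-# OPTIONS --safe #-}
-- A pre-morphism (f, φ) acts on threads by x ↦ (f n (x (φ n)))ₙ, so the n-th coordinate of
-- P (f, φ) is the surjection f n ∘ ev (φ n) and the range is dense.  Conversely, a
-- homomorphism h continuous at the identity is uniformly continuous: the n-th coordinate of
-- h x depends only on x (φ n) for a strictly increasing φ.  Since threads can be lifted
-- through the surjective bonding maps, ev (φ n) is surjective and h descends to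
-- homomorphisms f n : A (φ n) → B n, surjective when h has dense range, with P (f, φ) = h.
-- The same lifting makes P faithful, so P reflects isomorphisms as well as preserving them.
module Submission where

open import Defs
open import Level using (0ℓ)
open import Function using (_∘_)
open import Data.Nat
  using (ℕ; zero; suc; _+_; _⊔_; _≤_; _<_; _≤′_; ≤′-refl; ≤′-reflexive; ≤′-step; s≤s)
open import Data.Nat.Properties
  using (≤-refl; ≤-trans; <-trans; <⇒≤; ≤⇒≤′; s≤′s; m≤m+n; m≤n+m; m≤m⊔n; m≤n⊔m; m≢1+n+m)
open import Data.Product using (Σ-syntax; _×_; _,_; proj₁; proj₂)
open import Data.Empty using (⊥-elim)
open import Relation.Binary.PropositionalEquality using (_≡_; refl)
open import Algebra.Bundles using (Group)
open import Algebra.Morphism.Structures using (IsGroupHomomorphism)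
import Algebra.Morphism.Construct.Composition as Comp
import Algebra.Morphism.Construct.Identity as Ident
import Algebra.Properties.Group as GroupProperties

module _ {G H K : Group 0ℓ 0ℓ} where
  private
    module G = Group G
    module H = Group H
    module K = Group K

  kernel⊆⇒fibre⊆ : (u : Hom G K) (v : Hom G H) →
                   (∀ x → ⟦ u ⟧ x K.≈ K.ε → ⟦ v ⟧ x H.≈ H.ε) →
                   ∀ x y → ⟦ u ⟧ x K.≈ ⟦ u ⟧ y → ⟦ v ⟧ x H.≈ ⟦ v ⟧ y
  kernel⊆⇒fibre⊆ u v ker x y ux≈uy = x∙y⁻¹≈ε⇒x≈y _ _ (begin
      ⟦ v ⟧ x H.∙ ⟦ v ⟧ y H.⁻¹       ≈⟨ H.∙-congˡ (hom-⁻¹ v y) ⟨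
      ⟦ v ⟧ x H.∙ ⟦ v ⟧ (y G.⁻¹)     ≈⟨ hom-∙ v x (y G.⁻¹) ⟨
      ⟦ v ⟧ (x G.∙ y G.⁻¹)           ≈⟨ ker _ u[x∙y⁻¹]≈ε ⟩
      H.ε                            ∎)
    where
    open GroupProperties H using (x∙y⁻¹≈ε⇒x≈y)
    open import Relation.Binary.Reasoning.Setoid H.setoid
    u[x∙y⁻¹]≈ε : ⟦ u ⟧ (x G.∙ y G.⁻¹) K.≈ K.ε
    u[x∙y⁻¹]≈ε = K.trans (hom-∙ u x (y G.⁻¹))
      (K.trans (K.∙-congˡ (hom-⁻¹ u y)) (GroupProperties.x≈y⇒x∙y⁻¹≈ε K ux≈uy))

  module _ (π : Hom G K) (s : K.Carrier → G.Carrier) (π∘s : ∀ a → ⟦ π ⟧ (s a) K.≈ a)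
           (g : Hom G H) (g-fibre : ∀ x y → ⟦ π ⟧ x K.≈ ⟦ π ⟧ y → ⟦ g ⟧ x H.≈ ⟦ g ⟧ y)
           where

    private
      g∘s-fibre : ∀ {a x} → ⟦ π ⟧ x K.≈ a → ⟦ g ⟧ (s a) H.≈ ⟦ g ⟧ x
      g∘s-fibre πx≈a = g-fibre _ _ (K.trans (π∘s _) (K.sym πx≈a))

    descend : Hom K H
    descend = mkHom (⟦ g ⟧ ∘ s) record
      { isMonoidHomomorphism = record
        { isMagmaHomomorphism = record
          { isRelHomomorphism = record
            { cong = λ {a} {b} a≈b → g∘s-fibre (K.trans (π∘s b) (K.sym a≈b)) }
          ; homo = λ a b → H.trans
              (g∘s-fibre (K.trans (hom-∙ π (s a) (s b)) (K.∙-cong (π∘s a) (π∘s b))))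
              (hom-∙ g (s a) (s b))
          }
        ; ε-homo = H.trans (g∘s-fibre (hom-ε π)) (hom-ε g)
        }
      ; ⁻¹-homo = λ a → H.trans
          (g∘s-fibre (K.trans (hom-⁻¹ π (s a)) (K.⁻¹-cong (π∘s a))))
          (hom-⁻¹ g (s a))
      }

    descend-∘ : ∀ x → ⟦ descend ⟧ (⟦ π ⟧ x) H.≈ ⟦ g ⟧ x
    descend-∘ x = g∘s-fibre K.refl

    descend-surjective : Surjective g → Surjective descend
    descend-surjective g-surj b =
      let (x , gx≈b) = g-surj b in ⟦ π ⟧ x , H.trans (descend-∘ x) gx≈b

stepwise⇒StrictlyIncreasing : ∀ {φ} → (∀ n → φ n < φ (suc n)) → StrictlyIncreasing φ
stepwise⇒StrictlyIncreasing {φ} step {m} m<n = go (≤⇒≤′ m<n)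
  where
  go : ∀ {n} → suc m ≤′ n → φ m < φ n
  go ≤′-refl     = step m
  go (≤′-step h) = <-trans (go h) (step _)

strictMajorant : (ℕ → ℕ) → ℕ → ℕ
strictMajorant g zero    = g zero
strictMajorant g (suc n) = suc (strictMajorant g n + g (suc n))

≤-strictMajorant : ∀ g n → g n ≤ strictMajorant g n
≤-strictMajorant g zero    = ≤-refl
≤-strictMajorant g (suc n) = ≤-trans (m≤n+m _ (strictMajorant g n)) (m≤n+m _ 1)

strictMajorant-increasing : ∀ g → StrictlyIncreasing (strictMajorant g)
strictMajorant-increasing g = stepwise⇒StrictlyIncreasing λ n → s≤s (m≤m+n _ _)

module _ (S : InvSys) where
  private
    module Aₙ n = Group (A S n)

  proj′-isHom : ∀ {n k} (h : n ≤′ k) →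
                IsGroupHomomorphism (Group.rawGroup (A S k)) (Group.rawGroup (A S n)) (proj′ S h)
  proj′-isHom {k = k} ≤′-refl = Ident.isGroupHomomorphism _ (Aₙ.refl k)
  proj′-isHom (≤′-step {k} h) = Comp.isGroupHomomorphism (Aₙ.trans _) (isHom (p S k)) (proj′-isHom h)

  projHom : ∀ {n k} → n ≤′ k → Hom (A S k) (A S n)
  projHom h = mkHom (proj′ S h) (proj′-isHom h)

  proj-cong : ∀ {n k} (h : n ≤ k) {a b : El S k} → Eq S k a b → Eq S n (proj S h a) (proj S h b)
  proj-cong h = hom-cong (projHom (≤⇒≤′ h))

  proj-pt : (x : Thread S) {n k : ℕ} (h : n ≤ k) → Eq S n (proj S h (pt x k)) (pt x n)
  proj-pt x h = proj′-thread S x (≤⇒≤′ h)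

  p∘proj′ : ∀ {n k} (h : n ≤′ k) (b : El S (suc k)) →
            ⟦ p S n ⟧ (proj′ S (s≤′s h) b) ≡ proj′ S h (⟦ p S k ⟧ b)
  p∘proj′ ≤′-refl     b = refl
  p∘proj′ (≤′-step h) b = p∘proj′ h (⟦ p S _ ⟧ b)

  agree-at-top : ∀ {m} (x y : Thread S) → Eq S m (pt x m) (pt y m) → Agree S m x y
  agree-at-top x y xₘ≈yₘ k k≤m =
    Aₙ.trans k (Aₙ.sym k (proj-pt x k≤m)) (Aₙ.trans k (proj-cong k≤m xₘ≈yₘ) (proj-pt y k≤m))

  ev : ∀ n → Hom (Lim S) (A S n)
  ev n = mkHom (λ x → pt x n) record
    { isMonoidHomomorphism = record
      { isMagmaHomomorphism = record
        { isRelHomomorphism = record { cong = λ x≈y → x≈y n }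
        ; homo = λ _ _ → Aₙ.refl n }
      ; ε-homo = Aₙ.refl n }
    ; ⁻¹-homo = λ _ → Aₙ.refl n }

  module _ {m : ℕ} (a : El S m) where
    private
      preimages : (j : ℕ) → El S (j + m)
      preimages zero    = a
      preimages (suc j) = proj₁ (p-surj S (j + m) (preimages j))

      p-preimages : ∀ j → Eq S (j + m) (⟦ p S (j + m) ⟧ (preimages (suc j))) (preimages j)
      p-preimages j = proj₂ (p-surj S (j + m) (preimages j))

      proj-preimages : ∀ j (h : m ≤′ j + m) → Eq S m (proj′ S h (preimages j)) a
      proj-preimages zero    h           = Aₙ.reflexive m (proj′-self S h a)
      proj-preimages (suc j) (≤′-reflexive m≡1+j+m) = ⊥-elim (m≢1+n+m m m≡1+j+m)
      proj-preimages (suc j) (≤′-step h) =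
        Aₙ.trans m (hom-cong (projHom h) (p-preimages j)) (proj-preimages j h)

    -- The k-th coordinate is read off from A (k + m), where a has a chosen preimage.
    lift : Thread S
    lift = thread (λ k → proj S (m≤m+n k m) (preimages k)) λ k →
      Aₙ.trans k (Aₙ.reflexive k (p∘proj′ (≤⇒≤′ (m≤m+n k m)) (preimages (suc k))))
                 (proj-cong (m≤m+n k m) (p-preimages k))

    lift-top : Eq S m (pt lift m) a
    lift-top = proj-preimages m (≤⇒≤′ (m≤m+n m m))

  ev-surjective : ∀ n → Surjective (ev n)
  ev-surjective n a = lift a , lift-top a

  proj-lift : ∀ {n m} (h : n ≤ m) (a : El S m) → Eq S n (proj S h a) (pt (lift a) n)
  proj-lift h a = Aₙ.trans _ (proj-cong h (Aₙ.sym _ (lift-top a))) (proj-pt (lift a) h)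

∘H-surjective : {G H K : Group 0ℓ 0ℓ} (f : Hom G H) (g : Hom H K) →
                Surjective f → Surjective g → Surjective (g ∘H f)
∘H-surjective {K = K} f g f-surj g-surj c =
  let (b , gb≈c) = g-surj c
      (a , fa≈b) = f-surj b
  in a , Group.trans K (hom-cong g fa≈b) gb≈c

module _ {S T : InvSys} where
  private
    module Tₙ n = Group (A T n)

  DenseRange⇒ev∘-surjective : (h : Hom (Lim S) (Lim T)) → DenseRange ⟦ h ⟧ →
                               ∀ n → Surjective (ev T n ∘H h)
  DenseRange⇒ev∘-surjective h dense n b =
    let (x , hx≈lift) = dense (lift T b) n
    in x , Tₙ.trans n (hx≈lift n ≤-refl) (lift-top T b)

  ev∘-surjective⇒DenseRange : (h : Hom (Lim S) (Lim T)) → (∀ n → Surjective (ev T n ∘H h)) →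
                               DenseRange ⟦ h ⟧
  ev∘-surjective⇒DenseRange h surj y n =
    let (x , hxₙ≈yₙ) = surj n (pt y n) in x , agree-at-top T (⟦ h ⟧ x) y hxₙ≈yₙ

  rightInverse⇒DenseRange : (h : Hom (Lim S) (Lim T)) (g : Hom (Lim T) (Lim S)) →
                            (h ∘H g) ≗L idHom (Lim T) → DenseRange ⟦ h ⟧
  rightInverse⇒DenseRange h g hg≗id y n = ⟦ g ⟧ y , λ k _ → hg≗id y k

  P-continuous : (F : PreMor S T) → Continuous ⟦ P F ⟧
  P-continuous F x n =
    φ F n , λ y x≈y → agree-at-top T (P₀ F x) (P₀ F y) (hom-cong (f F n) (x≈y (φ F n) ≤-refl))

  P-dense : (F : PreMor S T) → DenseRange ⟦ P F ⟧
  P-dense F = ev∘-surjective⇒DenseRange (P F) λ n →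
    ∘H-surjective (ev S (φ F n)) (f F n) (ev-surjective S (φ F n)) (f-surj F n)

  P-resp-∼ : (F G : PreMor S T) → F ∼ G → P F ≗L P G
  P-resp-∼ F G F∼G x n =
    let (m , h₁ , h₂ , fF≈fG) = F∼G n
    in Tₙ.trans n (hom-cong (f F n) (Group.sym (A S _) (proj-pt S x h₁)))
         (Tₙ.trans n (fF≈fG (pt x m)) (hom-cong (f G n) (proj-pt S x h₂)))

  P-faithful : (F G : PreMor S T) → P F ≗L P G → F ∼ G
  P-faithful F G PF≗PG n = m , h₁ , h₂ , λ a →
    Tₙ.trans n (hom-cong (f F n) (proj-lift S h₁ a))
      (Tₙ.trans n (PF≗PG (lift S a) n) (Tₙ.sym n (hom-cong (f G n) (proj-lift S h₂ a))))
    where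
    m = φ F n ⊔ φ G n
    h₁ = m≤m⊔n (φ F n) (φ G n)
    h₂ = m≤n⊔m (φ F n) (φ G n)

  -- Continuity at the identity suffices, because h is a homomorphism.
  continuous⇒uniform : (h : Hom (Lim S) (Lim T)) → Continuous ⟦ h ⟧ →
    ∀ n → Σ[ m ∈ ℕ ] (∀ x y → Eq S m (pt x m) (pt y m) → Eq T n (pt (⟦ h ⟧ x) n) (pt (⟦ h ⟧ y) n))
  continuous⇒uniform h h-cont n = m , kernel⊆⇒fibre⊆ (ev S m) (ev T n ∘H h) ker⊆ker
    where
    m = proj₁ (h-cont (Group.ε (Lim S)) n)
    ker⊆ker : ∀ x → Eq S m (pt x m) (Group.ε (A S m)) → Eq T n (pt (⟦ h ⟧ x) n) (Tₙ.ε n)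
    ker⊆ker x xₘ≈ε = Tₙ.trans n (Tₙ.sym n (h[ε]≈h[x] n ≤-refl)) (hom-ε h n)
      where
      h[ε]≈h[x] : Agree T n (⟦ h ⟧ (Group.ε (Lim S))) (⟦ h ⟧ x)
      h[ε]≈h[x] = proj₂ (h-cont _ n) x (agree-at-top S (Group.ε (Lim S)) x (Group.sym (A S m) xₘ≈ε))

  module _ (h : Hom (Lim S) (Lim T)) (h-cont : Continuous ⟦ h ⟧) (h-dense : DenseRange ⟦ h ⟧) where
    private
      modulus : ℕ → ℕ
      modulus n = proj₁ (continuous⇒uniform h h-cont n)

      ψ : ℕ → ℕ
      ψ = strictMajorant modulus

      h-factors : ∀ n x y → Eq S (ψ n) (pt x (ψ n)) (pt y (ψ n)) →
                  Eq T n (pt (⟦ h ⟧ x) n) (pt (⟦ h ⟧ y) n)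
      h-factors n x y xψ≈yψ = proj₂ (continuous⇒uniform h h-cont n) x y
        (agree-at-top S x y xψ≈yψ (modulus n) (≤-strictMajorant modulus n))

      component : ∀ n → Hom (A S (ψ n)) (A T n)
      component n = descend (ev S (ψ n)) (lift S) (lift-top S) (ev T n ∘H h) (h-factors n)

      component-comm : ∀ {n k} (n<k : n < k) (a : El S (ψ k)) →
        Eq T n (proj T (<⇒≤ n<k) (⟦ component k ⟧ a))
               (⟦ component n ⟧ (proj S (<⇒≤ (strictMajorant-increasing modulus n<k)) a))
      component-comm {n} n<k a = Tₙ.trans n (proj-pt T (⟦ h ⟧ (lift S a)) (<⇒≤ n<k))
        (h-factors n _ _ (Group.trans (A S (ψ n)) (Group.sym (A S (ψ n)) (proj-lift S ψn≤ψk a))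
                                                   (Group.sym (A S (ψ n)) (lift-top S _))))
        where ψn≤ψk = <⇒≤ (strictMajorant-increasing modulus n<k)

    preimage : PreMor S T
    preimage = record
      { φ = ψ
      ; φ-inc = strictMajorant-increasing modulus
      ; f = component
      ; f-surj = λ n → descend-surjective (ev S (ψ n)) (lift S) (lift-top S) (ev T n ∘H h)
                   (h-factors n) (DenseRange⇒ev∘-surjective h h-dense n)
      ; f-comm = component-comm
      }

    P-preimage : P preimage ≗L h
    P-preimage x n = descend-∘ (ev S (ψ n)) (lift S) (lift-top S) (ev T n ∘H h) (h-factors n) x

P-full : (S T : InvSys) (h : Hom (Lim S) (Lim T)) → Continuous ⟦ h ⟧ → DenseRange ⟦ h ⟧ →
         Σ[ F ∈ PreMor S T ] P F ≗L h
P-full S T h h-cont h-dense = preimage h h-cont h-dense , P-preimage h h-cont h-dense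

P-inverse : {S T : InvSys} (F : PreMor S T) (G : PreMor T S)
            (h : Hom (Lim S) (Lim T)) (g : Hom (Lim T) (Lim S)) →
            P F ≗L h → P G ≗L g → (g ∘H h) ≗L idHom (Lim S) → (G ∘P F) ∼ idPre S
P-inverse {S} F G h g PF≗h PG≗g gh≗id = P-faithful (G ∘P F) (idPre S) λ x n →
  Group.trans (A S n) (hom-cong (P G) {⟦ P F ⟧ x} {⟦ h ⟧ x} (PF≗h x) n)
    (Group.trans (A S n) (PG≗g (⟦ h ⟧ x) n) (gh≗id x n))

ProIso⇒TopIso : (S T : InvSys) → ProIso S T → TopIso S T
ProIso⇒TopIso S T (F , G , GF∼id , FG∼id) =
  P F , P G , P-continuous F , P-continuous G ,
  P-resp-∼ (G ∘P F) (idPre S) GF∼id , P-resp-∼ (F ∘P G) (idPre T) FG∼id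

TopIso⇒ProIso : (S T : InvSys) → TopIso S T → ProIso S T
TopIso⇒ProIso S T (h , g , h-cont , g-cont , gh≗id , hg≗id) =
  F , G , P-inverse F G h g PF≗h PG≗g gh≗id , P-inverse G F g h PG≗g PF≗h hg≗id
  where
  F = proj₁ (P-full S T h h-cont (rightInverse⇒DenseRange h g hg≗id))
  PF≗h = proj₂ (P-full S T h h-cont (rightInverse⇒DenseRange h g hg≗id))
  G = proj₁ (P-full T S g g-cont (rightInverse⇒DenseRange g h gh≗id))
  PG≗g = proj₂ (P-full T S g g-cont (rightInverse⇒DenseRange g h gh≗id))

lemma3p7 :
    -- (i) P is a functor into procountable groups with continuous dense-range homomorphisms
    ((S T : InvSys) (F : PreMor S T) → Continuous ⟦ P F ⟧ × DenseRange ⟦ P F ⟧)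
    × ((S T : InvSys) (F G : PreMor S T) → F ∼ G → P F ≗L P G)
    × ((S : InvSys) → P (idPre S) ≗L idHom (Lim S))
    × ((S T U : InvSys) (F : PreMor S T) (G : PreMor T U) → P (G ∘P F) ≗L (P G ∘H P F))
    -- (i) P is full
    × ((S T : InvSys) (h : Hom (Lim S) (Lim T)) → Continuous ⟦ h ⟧ → DenseRange ⟦ h ⟧ →
         Σ[ F ∈ PreMor S T ] P F ≗L h)
    -- (ii) isomorphic in Pro_ω(GrpEpi) iff inverse limits topologically isomorphic
    × ((S T : InvSys) → (ProIso S T → TopIso S T) × (TopIso S T → ProIso S T))
lemma3p7 =
  (λ S T F → P-continuous F , P-dense F) ,
  (λ S T → P-resp-∼) ,
  (λ S x n → Group.refl (A S n)) ,
  (λ S T U F G x n → Group.refl (A U n)) ,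
  P-full ,
  λ S T → ProIso⇒TopIso S T , TopIso⇒ProIso S T
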